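{- For every constant $K\ge 1$ there is a constant $C>0$ such that ${\bf H}[f]\le C\cdot{\bf I}[f]$ holds for every Boolean function $f\colon\{ -1,1\}^n\to\{ -1,1\}$ (any $n$) satisfying at least one of the following: the minimal size of a sub-cube partition of $f$ is at most $K$; the degree of $f$ is at most $K$; the minimal depth of a decision tree computing $f$ is at most $K$; the minimal number of leaves of a decision tree computing $f$ is at most $K$; the granularity of $f$ is at most $K$; the number of nonzero Fourier coefficients of $f$ is at most $K$.
   Context: For $f$ with Fourier expansion $f=\sum_{S\subseteq[n]}\widehat f(S)\prod_{i\in S}x_i$: ${\bf H}[f]=\sum_S\widehat f(S)^2\log_2\frac1{\widehat f(S)^2}$ (with $0\log\frac10=0$) and ${\bf I}[f]=\sum_S\widehat f(S)^2|S|$. A sub-cube partition of $f$ is a partition of $\{ -1,1\}^n$ into subcubes (sets obtained by fixing some coordinates) on each of which $f$ is constant. The degree of $f$ is $\max\{|S|:\widehat f(S)\ne0\}$. The granularity of $f$ is the smallest $k$ such that every $\widehat f(S)$ is an integer multiple of $2^{ -k}$. Decision trees query one variable at each internal node and output a value at each leaf. -}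

module Defs where

open import Data.Bool using (Bool; true; false; if_then_else_; _∧_)
open import Data.Maybe using (Maybe; just; nothing)
open import Data.Nat using (ℕ; zero; suc; _+_; _*_; _^_; _≤_; _<_)
open import Data.Integer as ℤ using (ℤ)
open import Data.List using (List; []; _∷_; map; concatMap; length; filterᵇ; foldr)
open import Data.Nat.ListAction using (sum; product)
open import Data.List.Membership.Propositional using (_∈_)
open import Data.Vec using (Vec; []; _∷_)
open import Data.Fin using (Fin)
open import Data.Fin.Subset using (Subset; ∣_∣)
open import Data.Product using (Σ; ∃; ∃-syntax; _×_)
open import Data.Sum using (_⊎_)
open import Relation.Binary.PropositionalEquality using (_≡_)

-- Encoding of {-1,1}^n : a point is a Vec Bool n, with  false ↦ +1,
-- true ↦ -1.  A Boolean function f : {-1,1}^n → {-1,1} is a function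
-- Vec Bool n → Bool with the same encoding of the output.

BoolFun : ℕ → Set
BoolFun n = Vec Bool n → Bool

sign : Bool → ℤ
sign false = ℤ.1ℤ
sign true  = ℤ.-1ℤ

-- enumeration of all points of {-1,1}^n (also used for all subsets S ⊆ [n],
-- represented by their characteristic vectors  Subset n = Vec Bool n)
allVecs : (n : ℕ) → List (Vec Bool n)
allVecs zero    = [] ∷ []
allVecs (suc n) = concatMap (λ b → map (b ∷_) (allVecs n)) (false ∷ true ∷ [])

sumℤ : List ℤ → ℤ
sumℤ = foldr ℤ._+_ ℤ.0ℤ

chi : {n : ℕ} → Subset n → Vec Bool n → ℤ
chi []       []       = ℤ.1ℤ
chi (s ∷ S) (x ∷ xs) = (if s then sign x else ℤ.1ℤ) ℤ.* chi S xs

-- 2^n · \hat f(S) = Σ_x f(x) χ_S(x)   (an integer); so \hat f(S) = fourierNum f S / 2^n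
fourierNum : {n : ℕ} → BoolFun n → Subset n → ℤ
fourierNum {n} f S = sumℤ (map (λ x → sign (f x) ℤ.* chi S x) (allVecs n))

-- 4^n · \hat f(S)^2  (a natural number)
weight : {n : ℕ} → BoolFun n → Subset n → ℕ
weight f S = ℤ.∣ fourierNum f S ∣ ^ 2

isZeroℤ : ℤ → Bool
isZeroℤ (ℤ.+ zero) = true
isZeroℤ _          = false

not0 : ℤ → Bool
not0 z = if isZeroℤ z then false else true

-- Entropy vs influence.
-- 4^n · I[f] = Σ_S (4^n \hat f(S)^2) |S|
influenceNum : {n : ℕ} → BoolFun n → ℕ
influenceNum {n} f = sum (map (λ S → weight f S * ∣ S ∣) (allVecs n))

-- H[f] ≤ C · I[f], written with a_S = 4^n \hat f(S)^2 as
--   Σ_S a_S log₂(4^n / a_S) ≤ C · Σ_S a_S |S|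
-- and exponentiated (2^x is strictly monotone) and cleared of denominators:
--   ∏_S (4^n)^{a_S}  ≤  2^{C · Σ_S a_S |S|} · ∏_S a_S^{a_S}
-- (terms with a_S = 0 contribute factor 1 on both sides, matching 0 log(1/0) = 0).
EntropyInfluenceBound : ℕ → {n : ℕ} → BoolFun n → Set
EntropyInfluenceBound C {n} f =
  product (map (λ S → (4 ^ n) ^ weight f S) (allVecs n))
    ≤ (2 ^ (C * influenceNum f)) * product (map (λ S → weight f S ^ weight f S) (allVecs n))

DegreeAtMost : ℕ → {n : ℕ} → BoolFun n → Set
DegreeAtMost K {n} f = (S : Subset n) → ¬0 (fourierNum f S) → ∣ S ∣ ≤ K
  where
    ¬0 : ℤ → Set
    ¬0 z = not0 z ≡ true

SparsityAtMost : ℕ → {n : ℕ} → BoolFun n → Set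
SparsityAtMost K {n} f = length (filterᵇ (λ S → not0 (fourierNum f S)) (allVecs n)) ≤ K

-- granularity ≤ K : some k ≤ K with every \hat f(S) = fourierNum f S / 2^n
-- an integer multiple of 2^{-k}, i.e. 2^n divides 2^k · fourierNum f S.
GranularityAtMost : ℕ → {n : ℕ} → BoolFun n → Set
GranularityAtMost K {n} f =
  ∃[ k ] (k ≤ K × ((S : Subset n) →
    Σ ℤ (λ m → ℤ.+ (2 ^ k) ℤ.* fourierNum f S ≡ m ℤ.* ℤ.+ (2 ^ n))))

data DecisionTree (n : ℕ) : Set where
  leaf : Bool → DecisionTree n
  node : Fin n → DecisionTree n → DecisionTree n → DecisionTree n
  -- node i t₀ t₁ : query x_i; go to t₀ if x_i = +1 (false), t₁ if x_i = -1 (true)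

evalDT : {n : ℕ} → DecisionTree n → Vec Bool n → Bool
evalDT (leaf b)       x = b
evalDT (node i t₀ t₁) x = if Data.Vec.lookup x i then evalDT t₁ x else evalDT t₀ x

depth : {n : ℕ} → DecisionTree n → ℕ
depth (leaf _)       = 0
depth (node _ t₀ t₁) = suc (depth t₀ Data.Nat.⊔ depth t₁)

leaves : {n : ℕ} → DecisionTree n → ℕ
leaves (leaf _)       = 1
leaves (node _ t₀ t₁) = leaves t₀ + leaves t₁

Computes : {n : ℕ} → DecisionTree n → BoolFun n → Set
Computes t f = ∀ x → evalDT t x ≡ f x

DTDepthAtMost : ℕ → {n : ℕ} → BoolFun n → Set
DTDepthAtMost K f = ∃[ t ] (Computes t f × depth t ≤ K)

DTSizeAtMost : ℕ → {n : ℕ} → BoolFun n → Set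
DTSizeAtMost K f = ∃[ t ] (Computes t f × leaves t ≤ K)

-- subcubes: each coordinate fixed (just b) or free (nothing)
Subcube : ℕ → Set
Subcube n = Vec (Maybe Bool) n

inCube : {n : ℕ} → Subcube n → Vec Bool n → Bool
inCube []             []       = true
inCube (nothing ∷ c) (_ ∷ xs) = inCube c xs
inCube (just b ∷ c)  (x ∷ xs) = (if b then x else Data.Bool.not x) ∧ inCube c xs

IsSubcubePartition : {n : ℕ} → BoolFun n → List (Subcube n) → Set
IsSubcubePartition f cs =
  (∀ x → length (filterᵇ (λ c → inCube c x) cs) ≡ 1) ×
  (∀ c → c ∈ cs → ∀ x y → inCube c x ≡ true → inCube c y ≡ true → f x ≡ f y)

PartitionSizeAtMost : ℕ → {n : ℕ} → BoolFun n → Set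
PartitionSizeAtMost K f = ∃[ cs ] (IsSubcubePartition f cs × length cs ≤ K)

SomeMeasureAtMost : ℕ → {n : ℕ} → BoolFun n → Set
SomeMeasureAtMost K f =
  PartitionSizeAtMost K f ⊎ DegreeAtMost K f ⊎ DTDepthAtMost K f ⊎
  DTSizeAtMost K f ⊎ GranularityAtMost K f ⊎ SparsityAtMost K f

{-# OPTIONS --safe #-}
-- Every one of the six measures being at most K forces granularity at most K, that is
-- 2ᴷ f̂(S) ∈ ℤ for all S. Degree d gives granularity d by induction on n, splitting off the
-- first variable: f̂(S ∪ {1}) is half a coefficient of the difference of the two restrictions,
-- which has degree d - 1, and f̂(S) is f̂(S ∪ {1}) plus a coefficient of a restriction. A decision
-- tree of depth d, or with d + 1 leaves, computes a function of degree at most d; in a partition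
-- into s subcubes every cube has codimension below s, so f has degree below s; and sparsity s
-- gives granularity s, again by splitting off the first variable.
-- With granularity K every nonzero f̂(S)² is at least 4⁻ᴷ, so the term of H[f] at S is at most
-- 2K f̂(S)², which for S ≠ ∅ is at most 2K f̂(S)² |S|. The term at ∅ is at most 2K ≤ 2K 4ᴷ f̂(T)² |T|
-- for any nonempty T with f̂(T) ≠ 0; if there is no such T, f is constant and H[f] = 0.
-- Hence H[f] ≤ 2K (1 + 4ᴷ) I[f].
module Submission where

open import Algebra.Bundles using (Semiring)
open import Data.Bool using (false; true)
open import Data.List using (List; []; _∷_; map; _++_; length; filterᵇ)
open import Data.List.Membership.Propositional using (_∈_)
open import Data.List.Relation.Unary.Any using (here; there)
open import Data.Nat using (suc)
open import Data.Vec using (Vec; []; _∷_; lookup; tail; replicate; _[_]%=_)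
open import Defs
import Relation.Binary.PropositionalEquality as ≡

module ListSum {c ℓ} (R : Semiring c ℓ) where
  open Semiring R
  open import Relation.Binary.Reasoning.Setoid setoid

  ∑ : ∀ {a} {A : Set a} → List A → (A → Carrier) → Carrier
  ∑ xs h = Data.List.foldr _+_ 0# (map h xs)

  module _ {a} {A : Set a} where

    ∑-++ : ∀ (xs ys : List A) h → ∑ (xs ++ ys) h ≈ ∑ xs h + ∑ ys h
    ∑-++ []       ys h = sym (+-identityˡ _)
    ∑-++ (x ∷ xs) ys h = trans (+-congˡ (∑-++ xs ys h)) (sym (+-assoc _ _ _))

    ∑-cong : ∀ (xs : List A) {h k} → (∀ x → x ∈ xs → h x ≈ k x) → ∑ xs h ≈ ∑ xs k
    ∑-cong []       h≈k = refl
    ∑-cong (x ∷ xs) h≈k = +-cong (h≈k x (here ≡.refl)) (∑-cong xs (λ y y∈ → h≈k y (there y∈)))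

    ∑-zero : ∀ (xs : List A) {h} → (∀ x → x ∈ xs → h x ≈ 0#) → ∑ xs h ≈ 0#
    ∑-zero []       h≈0 = refl
    ∑-zero (x ∷ xs) h≈0 =
      trans (+-cong (h≈0 x (here ≡.refl)) (∑-zero xs (λ y y∈ → h≈0 y (there y∈)))) (+-identityˡ 0#)

    ∑-distrib-+ : ∀ (xs : List A) h k → ∑ xs (λ x → h x + k x) ≈ ∑ xs h + ∑ xs k
    ∑-distrib-+ []       h k = sym (+-identityˡ 0#)
    ∑-distrib-+ (x ∷ xs) h k = begin
      (h x + k x) + ∑ xs (λ y → h y + k y) ≈⟨ +-congˡ (∑-distrib-+ xs h k) ⟩
      (h x + k x) + (∑ xs h + ∑ xs k)      ≈⟨ +-assoc _ _ _ ⟩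
      h x + (k x + (∑ xs h + ∑ xs k))      ≈⟨ +-congˡ (x+[y+z]≈y+[x+z] (k x) _ _) ⟩
      h x + (∑ xs h + (k x + ∑ xs k))      ≈⟨ sym (+-assoc _ _ _) ⟩
      (h x + ∑ xs h) + (k x + ∑ xs k)      ∎
      where
        x+[y+z]≈y+[x+z] : ∀ u v w → u + (v + w) ≈ v + (u + w)
        x+[y+z]≈y+[x+z] u v w = trans (sym (+-assoc u v w)) (trans (+-congʳ (+-comm u v)) (+-assoc v u w))

    ∑-distribˡ-* : ∀ (xs : List A) c h → ∑ xs (λ x → c * h x) ≈ c * ∑ xs h
    ∑-distribˡ-* []       c h = sym (zeroʳ c)
    ∑-distribˡ-* (x ∷ xs) c h = trans (+-congˡ (∑-distribˡ-* xs c h)) (sym (distribˡ c _ _))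

    ∑-distribʳ-* : ∀ (xs : List A) c h → ∑ xs (λ x → h x * c) ≈ ∑ xs h * c
    ∑-distribʳ-* []       c h = sym (zeroˡ c)
    ∑-distribʳ-* (x ∷ xs) c h = trans (+-congˡ (∑-distribʳ-* xs c h)) (sym (distribʳ c _ _))

  ∑-map : ∀ {a b} {A : Set a} {B : Set b} (φ : A → B) xs h → ∑ (map φ xs) h ≈ ∑ xs (λ x → h (φ x))
  ∑-map φ []       h = refl
  ∑-map φ (x ∷ xs) h = +-congˡ (∑-map φ xs h)

  ∑-allVecs-suc : ∀ n h →
    ∑ (allVecs (suc n)) h ≈ ∑ (allVecs n) (λ x → h (false ∷ x)) + ∑ (allVecs n) (λ x → h (true ∷ x))
  ∑-allVecs-suc n h = begin
    ∑ (map (false ∷_) (allVecs n) ++ (map (true ∷_) (allVecs n) ++ [])) h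
      ≈⟨ ∑-++ (map (false ∷_) (allVecs n)) _ h ⟩
    ∑ (map (false ∷_) (allVecs n)) h + ∑ (map (true ∷_) (allVecs n) ++ []) h
      ≈⟨ +-congˡ (trans (∑-++ (map (true ∷_) (allVecs n)) [] h) (+-identityʳ _)) ⟩
    ∑ (map (false ∷_) (allVecs n)) h + ∑ (map (true ∷_) (allVecs n)) h
      ≈⟨ +-cong (∑-map (false ∷_) (allVecs n) h) (∑-map (true ∷_) (allVecs n) h) ⟩
    ∑ (allVecs n) (λ x → h (false ∷ x)) + ∑ (allVecs n) (λ x → h (true ∷ x)) ∎

  ∑-comm : ∀ {a b} {A : Set a} {B : Set b} (xs : List A) (ys : List B) (w : A → B → Carrier) →
           ∑ xs (λ x → ∑ ys (w x)) ≈ ∑ ys (λ y → ∑ xs (λ x → w x y))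
  ∑-comm []       ys w = sym (∑-zero ys (λ _ _ → refl))
  ∑-comm (x ∷ xs) ys w = trans (+-congˡ (∑-comm xs ys w)) (sym (∑-distrib-+ ys (w x) _))

open import Data.Bool using (Bool; not; _∧_; if_then_else_)
open import Data.Bool.Properties using (not-¬)
open import Data.Empty using (⊥-elim)
open import Data.Fin using (Fin; zero; suc)
import Data.Fin.Properties as FinP
open import Data.Fin.Subset using (Subset; ∣_∣)
open import Data.Integer as ℤ using (ℤ; +_; -[1+_]; _+_; _*_; _-_; 0ℤ; 1ℤ; -1ℤ)
open import Data.Integer.Divisibility.Signed
  using (_∣_; divides; ∣ᵤ⇒∣; ∣⇒∣ᵤ; *-monoʳ-∣; ∣n⇒∣m*n; ∣m∣n⇒∣m+n; ∣m∣n⇒∣m-n)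
import Data.Integer.Properties as ℤP
open import Data.Integer.Tactic.RingSolver using (solve-∀)
open import Data.List using (allFin)
open import Data.List.Membership.Propositional using (lose)
open import Data.List.Membership.Propositional.Properties using (∈-map⁺; ∈-++⁺ˡ; ∈-++⁺ʳ)
open import Data.List.Properties using (map-tabulate)
open import Data.List.Relation.Unary.Any using (any?; satisfied)
open import Data.Maybe using (just; nothing; is-just)
open import Data.Nat as ℕ using (ℕ; zero; _≤_; _<_; _^_; _∸_; _⊔_)
import Data.Nat.Divisibility as ND
open import Data.Nat.ListAction using (product)
import Data.Nat.Properties as ℕP
import Data.Nat.Tactic.RingSolver as ℕSolver
open import Data.Product using (_×_; _,_; proj₁; proj₂; ∃-syntax)
open import Data.Sum using (_⊎_; inj₁; inj₂)
open import Data.Vec.Properties using (lookup∘updateAt; lookup∘updateAt′)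
open import Function using (id; _∘_)
open import Relation.Binary.PropositionalEquality hiding ([_])
open import Relation.Nullary using (yes; no; ¬?; _×-dec_; decidable-stable)

module ℤ∑ = ListSum ℤP.+-*-semiring
module ℕ∑ = ListSum ℕP.+-*-semiring
open ℤ∑ using (∑)
open ℕ∑ using () renaming (∑ to ∑ℕ)

module _ {a} {A : Set a} where

  ∑ℕ-mono-≤ : ∀ (xs : List A) {h k} → (∀ x → x ∈ xs → h x ≤ k x) → ∑ℕ xs h ≤ ∑ℕ xs k
  ∑ℕ-mono-≤ []       h≤k = ℕ.z≤n
  ∑ℕ-mono-≤ (x ∷ xs) h≤k = ℕP.+-mono-≤ (h≤k x (here refl)) (∑ℕ-mono-≤ xs λ y y∈ → h≤k y (there y∈))

  ∈⇒≤∑ℕ : ∀ {xs : List A} h {x} → x ∈ xs → h x ≤ ∑ℕ xs h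
  ∈⇒≤∑ℕ {y ∷ xs} h (here refl) = ℕP.m≤m+n (h y) _
  ∈⇒≤∑ℕ {y ∷ xs} h (there x∈)  = ℕP.≤-trans (∈⇒≤∑ℕ h x∈) (ℕP.m≤n+m _ (h y))

  ∑ℕ≡0⇒≡0 : ∀ {xs : List A} h {x} → ∑ℕ xs h ≡ 0 → x ∈ xs → h x ≡ 0
  ∑ℕ≡0⇒≡0 h ∑≡0 x∈ = ℕP.n≤0⇒n≡0 (subst (_ ≤_) ∑≡0 (∈⇒≤∑ℕ h x∈))

  ∑ℕ≤length : ∀ (xs : List A) h → (∀ x → x ∈ xs → h x ≤ 1) → ∑ℕ xs h ≤ length xs
  ∑ℕ≤length []       h h≤1 = ℕ.z≤n
  ∑ℕ≤length (x ∷ xs) h h≤1 = ℕP.+-mono-≤ (h≤1 x (here refl)) (∑ℕ≤length xs h λ y y∈ → h≤1 y (there y∈))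

∣∑∣≤∑∣∣ : ∀ {A : Set} (xs : List A) h → ℤ.∣ ∑ xs h ∣ ≤ ∑ℕ xs λ x → ℤ.∣ h x ∣
∣∑∣≤∑∣∣ []       h = ℕ.z≤n
∣∑∣≤∑∣∣ (x ∷ xs) h = ℕP.≤-trans (ℤP.∣i+j∣≤∣i∣+∣j∣ (h x) _) (ℕP.+-monoʳ-≤ ℤ.∣ h x ∣ (∣∑∣≤∑∣∣ xs h))

∏≤2^∑*∏ : ∀ {A : Set} (xs : List A) (u v e : A → ℕ) → (∀ x → u x ≤ 2 ^ e x ℕ.* v x) →
          product (map u xs) ≤ 2 ^ ∑ℕ xs e ℕ.* product (map v xs)
∏≤2^∑*∏ []       u v e u≤ = ℕP.≤-refl
∏≤2^∑*∏ (x ∷ xs) u v e u≤ = begin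
  u x ℕ.* product (map u xs)
    ≤⟨ ℕP.*-mono-≤ (u≤ x) (∏≤2^∑*∏ xs u v e u≤) ⟩
  2 ^ e x ℕ.* v x ℕ.* (2 ^ ∑ℕ xs e ℕ.* product (map v xs))
    ≡⟨ interchange (2 ^ e x) (v x) (2 ^ ∑ℕ xs e) (product (map v xs)) ⟩
  2 ^ e x ℕ.* 2 ^ ∑ℕ xs e ℕ.* (v x ℕ.* product (map v xs))
    ≡⟨ cong (ℕ._* (v x ℕ.* product (map v xs))) (ℕP.^-distribˡ-+-* 2 (e x) (∑ℕ xs e)) ⟨
  2 ^ (e x ℕ.+ ∑ℕ xs e) ℕ.* (v x ℕ.* product (map v xs)) ∎
  where
    open ℕP.≤-Reasoning
    interchange : ∀ a b c d → a ℕ.* b ℕ.* (c ℕ.* d) ≡ a ℕ.* c ℕ.* (b ℕ.* d)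
    interchange = ℕSolver.solve-∀

allVecs-complete : ∀ {n} (x : Vec Bool n) → x ∈ allVecs n
allVecs-complete []                = here refl
allVecs-complete {suc n} (false ∷ x) = ∈-++⁺ˡ (∈-map⁺ (false ∷_) (allVecs-complete x))
allVecs-complete {suc n} (true ∷ x)  =
  ∈-++⁺ʳ (map (false ∷_) (allVecs n)) (∈-++⁺ˡ (∈-map⁺ (true ∷_) (allVecs-complete x)))

[_] : Bool → ℕ
[ true ]  = 1
[ false ] = 0

[b]≤1 : ∀ b → [ b ] ≤ 1
[b]≤1 true  = ℕP.≤-refl
[b]≤1 false = ℕ.z≤n

[b]≡0⇒b≡false : ∀ {b} → [ b ] ≡ 0 → b ≡ false
[b]≡0⇒b≡false {false} refl = refl

∧≡true : ∀ {a b} → (a ∧ b) ≡ true → a ≡ true × b ≡ true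
∧≡true {true} {true} _ = refl , refl

module _ {a} {A : Set a} (p : A → Bool) where

  length-filterᵇ : ∀ xs → length (filterᵇ p xs) ≡ ∑ℕ xs λ x → [ p x ]
  length-filterᵇ []       = refl
  length-filterᵇ (x ∷ xs) with p x
  ... | true  = cong suc (length-filterᵇ xs)
  ... | false = length-filterᵇ xs

  count≡1⇒unique : ∀ {xs y z} → (∑ℕ xs λ x → [ p x ]) ≡ 1 →
                   y ∈ xs → z ∈ xs → p y ≡ true → p z ≡ true → y ≡ z
  count≡1⇒unique {x ∷ xs} ∑≡1 y∈ z∈ py pz with p x in px
  count≡1⇒unique ∑≡1 (here refl) (here refl) py pz | true = refl
  count≡1⇒unique ∑≡1 (here refl) (there z∈)  py pz | true
    with () ← trans (sym pz) ([b]≡0⇒b≡false (∑ℕ≡0⇒≡0 (λ x → [ p x ]) (ℕP.suc-injective ∑≡1) z∈))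
  count≡1⇒unique ∑≡1 (there y∈)  _           py pz | true
    with () ← trans (sym py) ([b]≡0⇒b≡false (∑ℕ≡0⇒≡0 (λ x → [ p x ]) (ℕP.suc-injective ∑≡1) y∈))
  count≡1⇒unique ∑≡1 (here refl) _           py pz | false with () ← trans (sym py) px
  count≡1⇒unique ∑≡1 (there y∈)  (here refl) py pz | false with () ← trans (sym pz) px
  count≡1⇒unique ∑≡1 (there y∈)  (there z∈)  py pz | false = count≡1⇒unique ∑≡1 y∈ z∈ py pz

∑ℕ-allFin-suc : ∀ n (h : Fin (suc n) → ℕ) → ∑ℕ (allFin (suc n)) h ≡ h zero ℕ.+ ∑ℕ (allFin n) (λ i → h (suc i))
∑ℕ-allFin-suc n h =
  cong (h zero ℕ.+_) (trans (cong (λ is → ∑ℕ is h) (sym (map-tabulate id suc))) (ℕ∑.∑-map suc (allFin n) h))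

∑ℕ-allFin-≤1 : ∀ n (Q : Fin n → Bool) → (∀ i j → Q i ≡ true → Q j ≡ true → i ≡ j) →
               ∑ℕ (allFin n) (λ i → [ Q i ]) ≤ 1
∑ℕ-allFin-≤1 zero    Q unique = ℕ.z≤n
∑ℕ-allFin-≤1 (suc n) Q unique rewrite ∑ℕ-allFin-suc n (λ i → [ Q i ]) with Q zero in Q0
... | true  = ℕP.≤-reflexive (cong suc (ℕ∑.∑-zero (allFin n) λ i _ → notQsuc i))
  where
    notQsuc : ∀ i → [ Q (suc i) ] ≡ 0
    notQsuc i with Q (suc i) in Qi
    ... | true  with () ← unique zero (suc i) Q0 Qi
    ... | false = refl
... | false = ∑ℕ-allFin-≤1 n (λ i → Q (suc i)) λ i j Qi Qj → FinP.suc-injective (unique (suc i) (suc j) Qi Qj)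

∑1-allVecs≡2^n : ∀ n → (∑ℕ (allVecs n) λ _ → 1) ≡ 2 ^ n
∑1-allVecs≡2^n zero    = refl
∑1-allVecs≡2^n (suc n) = trans (ℕ∑.∑-allVecs-suc n _)
  (trans (cong₂ ℕ._+_ (∑1-allVecs≡2^n n) (∑1-allVecs≡2^n n)) (cong (2 ^ n ℕ.+_) (sym (ℕP.+-identityʳ _))))

count-empty : ∀ n → (∑ℕ (allVecs n) λ S → [ ∣ S ∣ ℕ.≡ᵇ 0 ]) ≡ 1
count-empty zero    = refl
count-empty (suc n) =
  trans (ℕ∑.∑-allVecs-suc n _) (cong₂ ℕ._+_ (count-empty n) (ℕ∑.∑-zero (allVecs n) λ _ _ → refl))

i+i≡0⇒i≡0 : ∀ i → i + i ≡ 0ℤ → i ≡ 0ℤ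
i+i≡0⇒i≡0 i i+i≡0 = ℤP.*-cancelˡ-≡ (+ 2) i 0ℤ (trans (2*i≡i+i i) i+i≡0)
  where
    2*i≡i+i : ∀ i → (1ℤ + 1ℤ) * i ≡ i + i
    2*i≡i+i = solve-∀

i+j≡0∧i-j≡0⇒i≡0 : ∀ i j → i + j ≡ 0ℤ → i - j ≡ 0ℤ → i ≡ 0ℤ
i+j≡0∧i-j≡0⇒i≡0 i j i+j≡0 i-j≡0 = i+i≡0⇒i≡0 i (trans (i+i≡[i+j]+[i-j] i j) (cong₂ _+_ i+j≡0 i-j≡0))
  where
    i+i≡[i+j]+[i-j] : ∀ i j → i + i ≡ (i + j) + (i - j)
    i+i≡[i+j]+[i-j] = solve-∀

i+j≡0∧i-j≡0⇒j≡0 : ∀ i j → i + j ≡ 0ℤ → i - j ≡ 0ℤ → j ≡ 0ℤ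
i+j≡0∧i-j≡0⇒j≡0 i j i+j≡0 i-j≡0 = i+i≡0⇒i≡0 j (trans (j+j≡[i+j]-[i-j] i j) (cong₂ _-_ i+j≡0 i-j≡0))
  where
    j+j≡[i+j]-[i-j] : ∀ i j → j + j ≡ (i + j) - (i - j)
    j+j≡[i+j]-[i-j] = solve-∀

i+j≡0⇒i-j≡i+i : ∀ i j → i + j ≡ 0ℤ → i - j ≡ i + i
i+j≡0⇒i-j≡i+i i j i+j≡0 = begin
  i - j              ≡⟨ i-j≡[i+i]-[i+j] i j ⟩
  (i + i) - (i + j)  ≡⟨ cong (λ z → (i + i) - z) i+j≡0 ⟩
  (i + i) + 0ℤ       ≡⟨ ℤP.+-identityʳ (i + i) ⟩
  i + i              ∎
  where
    open ≡-Reasoning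
    i-j≡[i+i]-[i+j] : ∀ i j → i - j ≡ (i + i) - (i + j)
    i-j≡[i+i]-[i+j] = solve-∀

i-j≡0⇒i+j≡i+i : ∀ i j → i - j ≡ 0ℤ → i + j ≡ i + i
i-j≡0⇒i+j≡i+i i j i-j≡0 = begin
  i + j              ≡⟨ i+j≡[i+i]-[i-j] i j ⟩
  (i + i) - (i - j)  ≡⟨ cong (λ z → (i + i) - z) i-j≡0 ⟩
  (i + i) + 0ℤ       ≡⟨ ℤP.+-identityʳ (i + i) ⟩
  i + i              ∎
  where
    open ≡-Reasoning
    i+j≡[i+i]-[i-j] : ∀ i j → i + j ≡ (i + i) - (i - j)
    i+j≡[i+i]-[i-j] = solve-∀

not0≢true⇒≡0 : ∀ {z} → not0 z ≢ true → z ≡ 0ℤ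
not0≢true⇒≡0 {+ zero}   _      = refl
not0≢true⇒≡0 {+ suc _}  z≢true = ⊥-elim (z≢true refl)
not0≢true⇒≡0 { -[1+ _ ]} z≢true = ⊥-elim (z≢true refl)

not0≡false⇒≡0 : ∀ {z} → not0 z ≡ false → z ≡ 0ℤ
not0≡false⇒≡0 z≡false = not0≢true⇒≡0 λ z≡true → false≢true (trans (sym z≡false) z≡true)
  where
    false≢true : false ≢ true
    false≢true ()

[m*n]^k≡m^k*n^k : ∀ m n k → (m ℕ.* n) ^ k ≡ m ^ k ℕ.* n ^ k
[m*n]^k≡m^k*n^k m n zero    = refl
[m*n]^k≡m^k*n^k m n (suc k) =
  trans (cong (m ℕ.* n ℕ.*_) ([m*n]^k≡m^k*n^k m n k)) (interchange m n (m ^ k) (n ^ k))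
  where
    interchange : ∀ a b c d → a ℕ.* b ℕ.* (c ℕ.* d) ≡ a ℕ.* c ℕ.* (b ℕ.* d)
    interchange = ℕSolver.solve-∀

[2^n]^2≡4^n : ∀ n → (2 ^ n) ^ 2 ≡ 4 ^ n
[2^n]^2≡4^n n = trans (ℕP.^-*-assoc 2 n 2) (trans (cong (2 ^_) (ℕP.*-comm n 2)) (sym (ℕP.^-*-assoc 2 2 n)))

2^[1+n]≡2*2^n : ∀ n → + (2 ^ suc n) ≡ + 2 * + (2 ^ n)
2^[1+n]≡2*2^n n = ℤP.pos-* 2 (2 ^ n)

2^[1+k]*z≡2*[2^k*z] : ∀ k z → + (2 ^ suc k) * z ≡ + 2 * (+ (2 ^ k) * z)
2^[1+k]*z≡2*[2^k*z] k z = trans (cong (_* z) (2^[1+n]≡2*2^n k)) (ℤP.*-assoc (+ 2) (+ (2 ^ k)) z)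

∣-double : ∀ n {z} → + (2 ^ n) ∣ z → + (2 ^ suc n) ∣ + 2 * z
∣-double n {z} 2ⁿ∣z = subst (_∣ + 2 * z) (sym (2^[1+n]≡2*2^n n)) (*-monoʳ-∣ (+ 2) 2ⁿ∣z)

∣0ℤ : ∀ k → k ∣ 0ℤ
∣0ℤ k = ∣ᵤ⇒∣ (ND._∣0 ℤ.∣ k ∣)

-- Fourier coefficients of integer-valued functions

ℤFun : ℕ → Set
ℤFun n = Vec Bool n → ℤ

asℤ : ∀ {n} → BoolFun n → ℤFun n
asℤ f x = sign (f x)

restrict : ∀ {a} {A : Set a} {n} → Bool → (Vec Bool (suc n) → A) → Vec Bool n → A
restrict b g x = g (b ∷ x)

-- 2ⁿ times the Fourier coefficient, so that  fourierNum f ≡ coeff (asℤ f)  by definition.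
coeff : ∀ {n} → ℤFun n → Subset n → ℤ
coeff {n} g S = ∑ (allVecs n) λ x → g x * chi S x

module _ {n : ℕ} where

  coeff-cong : ∀ {g h : ℤFun n} → (∀ x → g x ≡ h x) → ∀ S → coeff g S ≡ coeff h S
  coeff-cong g≗h S = ℤ∑.∑-cong (allVecs n) λ x _ → cong (_* chi S x) (g≗h x)

  coeff-+ : ∀ (g h : ℤFun n) S → coeff (λ x → g x + h x) S ≡ coeff g S + coeff h S
  coeff-+ g h S = trans (ℤ∑.∑-cong (allVecs n) λ x _ → ℤP.*-distribʳ-+ (chi S x) (g x) (h x))
                        (ℤ∑.∑-distrib-+ (allVecs n) _ _)

  coeff-*ˡ : ∀ c (g : ℤFun n) S → coeff (λ x → c * g x) S ≡ c * coeff g S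
  coeff-*ˡ c g S = trans (ℤ∑.∑-cong (allVecs n) λ x _ → ℤP.*-assoc c (g x) (chi S x))
                         (ℤ∑.∑-distribˡ-* (allVecs n) c _)

  coeff-sub : ∀ (g h : ℤFun n) S → coeff (λ x → g x - h x) S ≡ coeff g S - coeff h S
  coeff-sub g h S = begin
    coeff (λ x → g x - h x) S        ≡⟨ coeff-cong (λ x → cong (_+_ (g x)) (sym (ℤP.-1*i≡-i (h x)))) S ⟩
    coeff (λ x → g x + -1ℤ * h x) S  ≡⟨ coeff-+ g _ S ⟩
    coeff g S + coeff (λ x → -1ℤ * h x) S ≡⟨ cong (_+_ (coeff g S)) (trans (coeff-*ˡ -1ℤ h S) (ℤP.-1*i≡-i _)) ⟩
    coeff g S - coeff h S            ∎
    where open ≡-Reasoning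

  coeff-∑ : ∀ {a} {A : Set a} (cs : List A) (g : A → ℤFun n) S →
            coeff (λ x → ∑ cs λ c → g c x) S ≡ ∑ cs λ c → coeff (g c) S
  coeff-∑ []       g S = ℤ∑.∑-zero (allVecs n) λ x _ → ℤP.*-zeroˡ (chi S x)
  coeff-∑ (c ∷ cs) g S = trans (coeff-+ (g c) _ S) (cong (_+_ (coeff (g c) S)) (coeff-∑ cs g S))

coeff-false∷ : ∀ {n} (g : ℤFun (suc n)) S →
               coeff g (false ∷ S) ≡ coeff (restrict false g) S + coeff (restrict true g) S
coeff-false∷ {n} g S = trans (ℤ∑.∑-allVecs-suc n _) (cong₂ _+_ (drop1 false) (drop1 true))
  where
    drop1 : ∀ b → ∑ (allVecs n) (λ x → g (b ∷ x) * (1ℤ * chi S x)) ≡ coeff (restrict b g) S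
    drop1 b = ℤ∑.∑-cong (allVecs n) λ x _ → cong (g (b ∷ x) *_) (ℤP.*-identityˡ (chi S x))

coeff-true∷ : ∀ {n} (g : ℤFun (suc n)) S →
              coeff g (true ∷ S) ≡ coeff (restrict false g) S - coeff (restrict true g) S
coeff-true∷ {n} g S = begin
  coeff g (true ∷ S)
    ≡⟨ ℤ∑.∑-allVecs-suc n _ ⟩
  ∑ (allVecs n) (λ x → g (false ∷ x) * (1ℤ * chi S x)) + ∑ (allVecs n) (λ x → g (true ∷ x) * (-1ℤ * chi S x))
    ≡⟨ cong₂ _+_ (ℤ∑.∑-cong (allVecs n) λ x _ → cong (g (false ∷ x) *_) (ℤP.*-identityˡ (chi S x)))
                 (ℤ∑.∑-cong (allVecs n) λ x _ → a*[-1*b]≡-1*[a*b] (g (true ∷ x)) (chi S x)) ⟩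
  coeff (restrict false g) S + ∑ (allVecs n) (λ x → -1ℤ * (g (true ∷ x) * chi S x))
    ≡⟨ cong (_+_ (coeff (restrict false g) S)) (trans (ℤ∑.∑-distribˡ-* (allVecs n) -1ℤ _) (ℤP.-1*i≡-i _)) ⟩
  coeff (restrict false g) S - coeff (restrict true g) S ∎
  where
    open ≡-Reasoning
    a*[-1*b]≡-1*[a*b] : ∀ a b → a * (-1ℤ * b) ≡ -1ℤ * (a * b)
    a*[-1*b]≡-1*[a*b] = solve-∀

∣S∣≤1+∣toggle∣ : ∀ {n} (i : Fin n) S → ∣ S ∣ ≤ suc ∣ S [ i ]%= not ∣
∣S∣≤1+∣toggle∣ zero    (true ∷ S)  = ℕP.≤-refl
∣S∣≤1+∣toggle∣ zero    (false ∷ S) = ℕP.m≤n⇒m≤1+n (ℕP.n≤1+n _)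
∣S∣≤1+∣toggle∣ (suc i) (true ∷ S)  = ℕ.s≤s (∣S∣≤1+∣toggle∣ i S)
∣S∣≤1+∣toggle∣ (suc i) (false ∷ S) = ∣S∣≤1+∣toggle∣ i S

chi-toggle : ∀ {n} (i : Fin n) S x → chi (S [ i ]%= not) x ≡ sign (lookup x i) * chi S x
chi-toggle zero    (true ∷ S)  (b ∷ x) = trans (ℤP.*-identityˡ _) (sign*sign b (chi S x))
  where
    sign*sign : ∀ b z → z ≡ sign b * (sign b * z)
    sign*sign false z = sym (trans (ℤP.*-identityˡ _) (ℤP.*-identityˡ z))
    sign*sign true  z = sym (trans (sym (ℤP.*-assoc -1ℤ -1ℤ z)) (ℤP.*-identityˡ z))
chi-toggle zero    (false ∷ S) (b ∷ x) = cong (sign b *_) (sym (ℤP.*-identityˡ _))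
chi-toggle (suc i) (s ∷ S)     (b ∷ x) = begin
  (if s then sign b else 1ℤ) * chi (S [ i ]%= not) x
    ≡⟨ cong ((if s then sign b else 1ℤ) *_) (chi-toggle i S x) ⟩
  (if s then sign b else 1ℤ) * (sign (lookup x i) * chi S x)
    ≡⟨ a*[b*c]≡b*[a*c] (if s then sign b else 1ℤ) (sign (lookup x i)) (chi S x) ⟩
  sign (lookup x i) * ((if s then sign b else 1ℤ) * chi S x) ∎
  where
    open ≡-Reasoning
    a*[b*c]≡b*[a*c] : ∀ a b c → a * (b * c) ≡ b * (a * c)
    a*[b*c]≡b*[a*c] = solve-∀

coeff-*variable : ∀ {n} (i : Fin n) (g : ℤFun n) S →
                  coeff (λ x → sign (lookup x i) * g x) S ≡ coeff g (S [ i ]%= not)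
coeff-*variable {n} i g S = ℤ∑.∑-cong (allVecs n) λ x _ →
  trans (a*b*c≡b*[a*c] (sign (lookup x i)) (g x) (chi S x)) (cong (g x *_) (sym (chi-toggle i S x)))
  where
    a*b*c≡b*[a*c] : ∀ a b c → a * b * c ≡ b * (a * c)
    a*b*c≡b*[a*c] = solve-∀

-- Degree

record Degree≤ {n} (d : ℕ) (g : ℤFun n) : Set where
  field vanish : ∀ S → d < ∣ S ∣ → coeff g S ≡ 0ℤ
open Degree≤

module _ {n : ℕ} where

  degree-mono : ∀ {d e} {g : ℤFun n} → d ≤ e → Degree≤ d g → Degree≤ e g
  vanish (degree-mono d≤e deg) S e<∣S∣ = vanish deg S (ℕP.≤-<-trans d≤e e<∣S∣)

  degree-cong : ∀ {d} {g h : ℤFun n} → (∀ x → g x ≡ h x) → Degree≤ d g → Degree≤ d h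
  vanish (degree-cong g≗h deg) S d<∣S∣ = trans (sym (coeff-cong g≗h S)) (vanish deg S d<∣S∣)

  degree-+ : ∀ {d} {g h : ℤFun n} → Degree≤ d g → Degree≤ d h → Degree≤ d (λ x → g x + h x)
  vanish (degree-+ {g = g} {h} deg-g deg-h) S d<∣S∣ =
    trans (coeff-+ g h S) (cong₂ _+_ (vanish deg-g S d<∣S∣) (vanish deg-h S d<∣S∣))

  degree-sub : ∀ {d} {g h : ℤFun n} → Degree≤ d g → Degree≤ d h → Degree≤ d (λ x → g x - h x)
  vanish (degree-sub {g = g} {h} deg-g deg-h) S d<∣S∣ =
    trans (coeff-sub g h S) (cong₂ _-_ (vanish deg-g S d<∣S∣) (vanish deg-h S d<∣S∣))

  degree-*variable : ∀ {d} {g : ℤFun n} i → Degree≤ d g → Degree≤ (suc d) (λ x → sign (lookup x i) * g x)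
  vanish (degree-*variable {g = g} i deg) S 1+d<∣S∣ =
    trans (coeff-*variable i g S)
          (vanish deg (S [ i ]%= not) (ℕ.s≤s⁻¹ (ℕP.≤-trans 1+d<∣S∣ (∣S∣≤1+∣toggle∣ i S))))

  degree-halve : ∀ {d} {g : ℤFun n} → Degree≤ d (λ x → + 2 * g x) → Degree≤ d g
  vanish (degree-halve {g = g} deg) S d<∣S∣ =
    ℤP.*-cancelˡ-≡ (+ 2) (coeff g S) 0ℤ (trans (sym (coeff-*ˡ (+ 2) g S)) (vanish deg S d<∣S∣))

  degree-restrict : ∀ {d} {g : ℤFun (suc n)} b → Degree≤ d g → Degree≤ d (restrict b g)
  vanish (degree-restrict {g = g} b deg) S d<∣S∣ = pick b
    where
      a₀ = coeff (restrict false g) S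
      a₁ = coeff (restrict true g) S
      a₀+a₁≡0 : a₀ + a₁ ≡ 0ℤ
      a₀+a₁≡0 = trans (sym (coeff-false∷ g S)) (vanish deg (false ∷ S) d<∣S∣)
      a₀-a₁≡0 : a₀ - a₁ ≡ 0ℤ
      a₀-a₁≡0 = trans (sym (coeff-true∷ g S)) (vanish deg (true ∷ S) (ℕP.m<n⇒m<1+n d<∣S∣))
      pick : ∀ b → coeff (restrict b g) S ≡ 0ℤ
      pick false = i+j≡0∧i-j≡0⇒i≡0 a₀ a₁ a₀+a₁≡0 a₀-a₁≡0
      pick true  = i+j≡0∧i-j≡0⇒j≡0 a₀ a₁ a₀+a₁≡0 a₀-a₁≡0

  degree-fromRestrictions : ∀ {d} {g : ℤFun (suc n)} →
    Degree≤ d (restrict false g) → Degree≤ d (restrict true g) → Degree≤ (suc d) g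
  vanish (degree-fromRestrictions {g = g} deg₀ deg₁) (false ∷ S) 1+d<∣S∣ =
    trans (coeff-false∷ g S) (cong₂ _+_ (vanish deg₀ S d<∣S∣) (vanish deg₁ S d<∣S∣))
    where d<∣S∣ = ℕP.<-trans (ℕP.n<1+n _) 1+d<∣S∣
  vanish (degree-fromRestrictions {g = g} deg₀ deg₁) (true ∷ S) 1+d<∣S∣ =
    trans (coeff-true∷ g S) (cong₂ _-_ (vanish deg₀ S (ℕ.s≤s⁻¹ 1+d<∣S∣)) (vanish deg₁ S (ℕ.s≤s⁻¹ 1+d<∣S∣)))

  degree-∘tail : ∀ {d} {h : ℤFun n} → Degree≤ d h → Degree≤ d (λ x → h (tail x))
  vanish (degree-∘tail {h = h} deg) (false ∷ S) d<∣S∣ =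
    trans (coeff-false∷ (λ x → h (tail x)) S) (cong₂ _+_ (vanish deg S d<∣S∣) (vanish deg S d<∣S∣))
  vanish (degree-∘tail {h = h} deg) (true ∷ S) d<∣S∣ =
    trans (coeff-true∷ (λ x → h (tail x)) S) (ℤP.+-inverseʳ (coeff h S))

  degree-*ˡ : ∀ {d} {g : ℤFun n} a → Degree≤ d g → Degree≤ d (λ x → a * g x)
  vanish (degree-*ˡ {g = g} a deg) S d<∣S∣ =
    trans (coeff-*ˡ a g S) (trans (cong (a *_) (vanish deg S d<∣S∣)) (ℤP.*-zeroʳ a))

  degree-∑ : ∀ {d} {A : Set} (cs : List A) (g : A → ℤFun n) →
             (∀ c → c ∈ cs → Degree≤ d (g c)) → Degree≤ d (λ x → ∑ cs λ c → g c x)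
  vanish (degree-∑ cs g deg) S d<∣S∣ =
    trans (coeff-∑ cs g S) (ℤ∑.∑-zero cs λ c c∈cs → vanish (deg c c∈cs) S d<∣S∣)

degree-const : ∀ {n} c → Degree≤ 0 (λ (_ : Vec Bool n) → c)
vanish (degree-const {zero}  c) [] ()
degree-const {suc n} c = degree-∘tail (degree-const c)

degree0⇒constant : ∀ {n} {g : ℤFun n} → Degree≤ 0 g →
                   ∀ {S} → ∣ S ∣ ≡ 0 → ∀ x → coeff g S ≡ + (2 ^ n) * g x
degree0⇒constant {zero}  {g} deg {[]} _ [] = c*1+0≡1*c (g [])
  where
    c*1+0≡1*c : ∀ c → c * 1ℤ + 0ℤ ≡ 1ℤ * c
    c*1+0≡1*c = solve-∀
degree0⇒constant {suc n} {g} deg {false ∷ S} ∣S∣≡0 (b ∷ x) = begin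
  coeff g (false ∷ S)                                  ≡⟨ coeff-false∷ g S ⟩
  coeff (restrict false g) S + coeff (restrict true g) S ≡⟨ both b ⟩
  coeff (restrict b g) S + coeff (restrict b g) S      ≡⟨ cong₂ _+_ IH IH ⟩
  + (2 ^ n) * g (b ∷ x) + + (2 ^ n) * g (b ∷ x)        ≡⟨ c+c≡2*c (+ (2 ^ n)) (g (b ∷ x)) ⟩
  + 2 * + (2 ^ n) * g (b ∷ x)                          ≡⟨ cong (_* g (b ∷ x)) (2^[1+n]≡2*2^n n) ⟨
  + (2 ^ suc n) * g (b ∷ x)                            ∎
  where
    open ≡-Reasoning
    IH : coeff (restrict b g) S ≡ + (2 ^ n) * g (b ∷ x)
    IH = degree0⇒constant (degree-restrict b deg) {S} ∣S∣≡0 x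
    a₀≡a₁ : coeff (restrict false g) S ≡ coeff (restrict true g) S
    a₀≡a₁ = ℤP.i-j≡0⇒i≡j _ _ (trans (sym (coeff-true∷ g S)) (vanish deg (true ∷ S) (ℕ.s≤s ℕ.z≤n)))
    both : ∀ b → coeff (restrict false g) S + coeff (restrict true g) S ≡
                  coeff (restrict b g) S + coeff (restrict b g) S
    both false = cong (_+_ (coeff (restrict false g) S)) (sym a₀≡a₁)
    both true  = cong (_+ coeff (restrict true g) S) a₀≡a₁
    c+c≡2*c : ∀ c y → c * y + c * y ≡ (1ℤ + 1ℤ) * c * y
    c+c≡2*c = solve-∀
degree0⇒constant {suc n} deg {true ∷ S} () _

nonconstant-or-degree0 : ∀ {n} (g : ℤFun n) → (∃[ T ] (0 < ∣ T ∣ × coeff g T ≢ 0ℤ)) ⊎ Degree≤ 0 g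
nonconstant-or-degree0 {n} g with any? (λ T → (0 ℕ.<? ∣ T ∣) ×-dec ¬? (coeff g T ℤ.≟ 0ℤ)) (allVecs n)
... | yes witness = inj₁ (satisfied witness)
... | no  none    = inj₂ (record { vanish = λ S 0<∣S∣ →
        decidable-stable (coeff g S ℤ.≟ 0ℤ) λ c≢0 → none (lose (allVecs-complete S) (0<∣S∣ , c≢0)) })

DegreeAtMost⇒Degree≤ : ∀ {K n} {f : BoolFun n} → DegreeAtMost K f → Degree≤ K (asℤ f)
vanish (DegreeAtMost⇒Degree≤ deg) S K<∣S∣ = not0≢true⇒≡0 λ nonzero → ℕP.<⇒≱ K<∣S∣ (deg S nonzero)

-- Granularity

record Granularity≤ {n} (k : ℕ) (g : ℤFun n) : Set where
  field dyadic : ∀ S → + (2 ^ n) ∣ + (2 ^ k) * coeff g S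
open Granularity≤

granularity-mono : ∀ {n k l} {g : ℤFun n} → k ≤ l → Granularity≤ k g → Granularity≤ l g
dyadic (granularity-mono {k = k} {l} {g} k≤l gran) S =
  subst (_ ∣_) 2^[l-k]*[2^k*c]≡2^l*c (∣n⇒∣m*n (+ (2 ^ (l ∸ k))) (dyadic gran S))
  where
    open ≡-Reasoning
    2^[l-k]*[2^k*c]≡2^l*c : + (2 ^ (l ∸ k)) * (+ (2 ^ k) * coeff g S) ≡ + (2 ^ l) * coeff g S
    2^[l-k]*[2^k*c]≡2^l*c = begin
      + (2 ^ (l ∸ k)) * (+ (2 ^ k) * coeff g S) ≡⟨ ℤP.*-assoc (+ (2 ^ (l ∸ k))) (+ (2 ^ k)) (coeff g S) ⟨
      + (2 ^ (l ∸ k)) * + (2 ^ k) * coeff g S   ≡⟨ cong (_* coeff g S) (ℤP.pos-* (2 ^ (l ∸ k)) (2 ^ k)) ⟨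
      + (2 ^ (l ∸ k) ℕ.* 2 ^ k) * coeff g S    ≡⟨ cong (λ m → + m * coeff g S) (ℕP.^-distribˡ-+-* 2 (l ∸ k) k) ⟨
      + (2 ^ (l ∸ k ℕ.+ k)) * coeff g S       ≡⟨ cong (λ m → + (2 ^ m) * coeff g S) (ℕP.m∸n+n≡m k≤l) ⟩
      + (2 ^ l) * coeff g S                   ∎

GranularityAtMost⇒Granularity≤ : ∀ {K n} {f : BoolFun n} → GranularityAtMost K f → Granularity≤ K (asℤ f)
GranularityAtMost⇒Granularity≤ (k , k≤K , multiple) =
  granularity-mono k≤K (record { dyadic = λ S → divides (proj₁ (multiple S)) (proj₂ (multiple S)) })

granularity-fromRestrictions : ∀ {n k} {g : ℤFun (suc n)} →
  Granularity≤ k (restrict false g) → Granularity≤ k (restrict true g) → Granularity≤ (suc k) g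
dyadic (granularity-fromRestrictions {n} {k} {g} gran₀ gran₁) (false ∷ S) =
  subst (_ ∣_) (sym 2^[1+k]*c≡2*[2^k*a+2^k*b]) (∣-double n (∣m∣n⇒∣m+n (dyadic gran₀ S) (dyadic gran₁ S)))
  where
    open ≡-Reasoning
    a = coeff (restrict false g) S
    b = coeff (restrict true g) S
    2^[1+k]*c≡2*[2^k*a+2^k*b] : + (2 ^ suc k) * coeff g (false ∷ S) ≡ + 2 * (+ (2 ^ k) * a + + (2 ^ k) * b)
    2^[1+k]*c≡2*[2^k*a+2^k*b] = begin
      + (2 ^ suc k) * coeff g (false ∷ S)    ≡⟨ cong (+ (2 ^ suc k) *_) (coeff-false∷ g S) ⟩
      + (2 ^ suc k) * (a + b)               ≡⟨ 2^[1+k]*z≡2*[2^k*z] k (a + b) ⟩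
      + 2 * (+ (2 ^ k) * (a + b))           ≡⟨ cong (+ 2 *_) (ℤP.*-distribˡ-+ (+ (2 ^ k)) a b) ⟩
      + 2 * (+ (2 ^ k) * a + + (2 ^ k) * b) ∎
dyadic (granularity-fromRestrictions {n} {k} {g} gran₀ gran₁) (true ∷ S) =
  subst (_ ∣_) (sym 2^[1+k]*c≡2*[2^k*a-2^k*b]) (∣-double n (∣m∣n⇒∣m-n (dyadic gran₀ S) (dyadic gran₁ S)))
  where
    open ≡-Reasoning
    a = coeff (restrict false g) S
    b = coeff (restrict true g) S
    c*[a-b]≡c*a-c*b : ∀ c a b → c * (a - b) ≡ c * a - c * b
    c*[a-b]≡c*a-c*b = solve-∀
    2^[1+k]*c≡2*[2^k*a-2^k*b] : + (2 ^ suc k) * coeff g (true ∷ S) ≡ + 2 * (+ (2 ^ k) * a - + (2 ^ k) * b)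
    2^[1+k]*c≡2*[2^k*a-2^k*b] = begin
      + (2 ^ suc k) * coeff g (true ∷ S)     ≡⟨ cong (+ (2 ^ suc k) *_) (coeff-true∷ g S) ⟩
      + (2 ^ suc k) * (a - b)               ≡⟨ 2^[1+k]*z≡2*[2^k*z] k (a - b) ⟩
      + 2 * (+ (2 ^ k) * (a - b))           ≡⟨ cong (+ 2 *_) (c*[a-b]≡c*a-c*b (+ (2 ^ k)) a b) ⟩
      + 2 * (+ (2 ^ k) * a - + (2 ^ k) * b) ∎

dyadic-true∷ : ∀ {n d} {g : ℤFun (suc n)} → Degree≤ d g →
               ∀ S → + (2 ^ suc n) ∣ + (2 ^ d) * coeff g (true ∷ S)
degree⇒granularity : ∀ {n d} {g : ℤFun n} → Degree≤ d g → Granularity≤ d g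

dyadic-true∷ {n} {zero} deg S =
  subst (λ c → + (2 ^ suc n) ∣ 1ℤ * c) (sym (vanish deg (true ∷ S) (ℕ.s≤s ℕ.z≤n))) (∣0ℤ _)
dyadic-true∷ {n} {suc d} {g} deg S =
  subst (_ ∣_) 2*[2^d*c]≡2^[1+d]*c (∣-double n (dyadic (degree⇒granularity deg-g₀-g₁) S))
  where
    g₀-g₁ : ℤFun n
    g₀-g₁ x = restrict false g x - restrict true g x
    coeff-g₀-g₁ : ∀ S → coeff g₀-g₁ S ≡ coeff g (true ∷ S)
    coeff-g₀-g₁ S = trans (coeff-sub (restrict false g) (restrict true g) S) (sym (coeff-true∷ g S))
    deg-g₀-g₁ : Degree≤ d g₀-g₁
    vanish deg-g₀-g₁ S d<∣S∣ = trans (coeff-g₀-g₁ S) (vanish deg (true ∷ S) (ℕ.s≤s d<∣S∣))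
    2*[2^d*c]≡2^[1+d]*c : + 2 * (+ (2 ^ d) * coeff g₀-g₁ S) ≡ + (2 ^ suc d) * coeff g (true ∷ S)
    2*[2^d*c]≡2^[1+d]*c =
      trans (sym (2^[1+k]*z≡2*[2^k*z] d (coeff g₀-g₁ S))) (cong (+ (2 ^ suc d) *_) (coeff-g₀-g₁ S))

dyadic (degree⇒granularity {zero}  deg) []          = ∣ᵤ⇒∣ (ND.1∣ _)
dyadic (degree⇒granularity {suc n} deg) (true ∷ S)  = dyadic-true∷ deg S
dyadic (degree⇒granularity {suc n} {d} {g} deg) (false ∷ S) =
  subst (_ ∣_) (sym split)
    (∣m∣n⇒∣m+n (dyadic-true∷ deg S) (∣-double n (dyadic (degree⇒granularity (degree-restrict true deg)) S)))
  where
    open ≡-Reasoning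
    a = coeff (restrict false g) S
    b = coeff (restrict true g) S
    c*[a+b]≡c*[a-b]+2*[c*b] : ∀ c a b → c * (a + b) ≡ c * (a - b) + (1ℤ + 1ℤ) * (c * b)
    c*[a+b]≡c*[a-b]+2*[c*b] = solve-∀
    split : + (2 ^ d) * coeff g (false ∷ S) ≡ + (2 ^ d) * coeff g (true ∷ S) + + 2 * (+ (2 ^ d) * b)
    split = begin
      + (2 ^ d) * coeff g (false ∷ S)
        ≡⟨ cong (+ (2 ^ d) *_) (coeff-false∷ g S) ⟩
      + (2 ^ d) * (a + b)
        ≡⟨ c*[a+b]≡c*[a-b]+2*[c*b] (+ (2 ^ d)) a b ⟩
      + (2 ^ d) * (a - b) + + 2 * (+ (2 ^ d) * b)
        ≡⟨ cong (λ z → + (2 ^ d) * z + + 2 * (+ (2 ^ d) * b)) (coeff-true∷ g S) ⟨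
      + (2 ^ d) * coeff g (true ∷ S) + + 2 * (+ (2 ^ d) * b) ∎

-- Decision trees

module _ {n : ℕ} where

  node-expansion : ∀ i (t₀ t₁ : DecisionTree n) x →
    let g₀ = asℤ (evalDT t₀); g₁ = asℤ (evalDT t₁) in
    (g₀ x + g₁ x) + sign (lookup x i) * (g₀ x - g₁ x) ≡ + 2 * asℤ (evalDT (node i t₀ t₁)) x
  node-expansion i t₀ t₁ x with lookup x i
  ... | false = [a+b]+1*[a-b]≡2*a (asℤ (evalDT t₀) x) (asℤ (evalDT t₁) x)
    where
      [a+b]+1*[a-b]≡2*a : ∀ a b → (a + b) + 1ℤ * (a - b) ≡ (1ℤ + 1ℤ) * a
      [a+b]+1*[a-b]≡2*a = solve-∀
  ... | true = [a+b]-1*[a-b]≡2*b (asℤ (evalDT t₀) x) (asℤ (evalDT t₁) x)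
    where
      [a+b]-1*[a-b]≡2*b : ∀ a b → (a + b) + -1ℤ * (a - b) ≡ (1ℤ + 1ℤ) * b
      [a+b]-1*[a-b]≡2*b = solve-∀

  degree≤depth : ∀ (t : DecisionTree n) → Degree≤ (depth t) (asℤ (evalDT t))
  degree≤depth (leaf b)       = degree-const (sign b)
  degree≤depth (node i t₀ t₁) =
    degree-halve {g = asℤ (evalDT (node i t₀ t₁))}
      (degree-cong (node-expansion i t₀ t₁)
        (degree-+ (degree-mono (ℕP.n≤1+n _) (degree-+ deg₀ deg₁))
                  (degree-*variable i (degree-sub deg₀ deg₁))))
    where
      deg₀ = degree-mono (ℕP.m≤m⊔n (depth t₀) (depth t₁)) (degree≤depth t₀)
      deg₁ = degree-mono (ℕP.m≤n⊔m (depth t₀) (depth t₁)) (degree≤depth t₁)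

  depth<leaves : ∀ (t : DecisionTree n) → depth t < leaves t
  depth<leaves (leaf _)       = ℕP.≤-refl
  depth<leaves (node i t₀ t₁) = begin-strict
    suc (depth t₀ ⊔ depth t₁)       ≤⟨ ℕ.s≤s (ℕP.m⊔n≤m+n (depth t₀) (depth t₁)) ⟩
    suc (depth t₀ ℕ.+ depth t₁)     <⟨ ℕP.+-mono-≤-< (depth<leaves t₀) (depth<leaves t₁) ⟩
    leaves t₀ ℕ.+ leaves t₁         ∎
    where open ℕP.≤-Reasoning

module _ {K n : ℕ} {f : BoolFun n} where

  computes⇒Degree≤depth : ∀ {t} → Computes t f → Degree≤ (depth t) (asℤ f)
  computes⇒Degree≤depth {t} computes = degree-cong (λ x → cong sign (computes x)) (degree≤depth t)

  DTDepthAtMost⇒Degree≤ : DTDepthAtMost K f → Degree≤ K (asℤ f)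
  DTDepthAtMost⇒Degree≤ (t , computes , depth≤K) = degree-mono depth≤K (computes⇒Degree≤depth computes)

  DTSizeAtMost⇒Degree≤ : DTSizeAtMost K f → Degree≤ K (asℤ f)
  DTSizeAtMost⇒Degree≤ (t , computes , leaves≤K) =
    degree-mono (ℕP.<⇒≤ (ℕP.<-≤-trans (depth<leaves t) leaves≤K)) (computes⇒Degree≤depth computes)

-- Subcube partitions

𝟙 : ∀ {n} → Subcube n → ℤFun n
𝟙 c x = if inCube c x then 1ℤ else 0ℤ

codim : ∀ {n} → Subcube n → ℕ
codim []            = 0
codim (nothing ∷ c) = codim c
codim (just _ ∷ c)  = suc (codim c)

corner : ∀ {n} → Subcube n → Vec Bool n
corner []            = []
corner (nothing ∷ c) = false ∷ corner c
corner (just b ∷ c)  = b ∷ corner c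

corner∈ : ∀ {n} (c : Subcube n) → inCube c (corner c) ≡ true
corner∈ []               = refl
corner∈ (nothing ∷ c)    = corner∈ c
corner∈ (just true ∷ c)  = corner∈ c
corner∈ (just false ∷ c) = corner∈ c

degree-𝟙 : ∀ {n} (c : Subcube n) → Degree≤ (codim c) (𝟙 c)
vanish (degree-𝟙 []) [] ()
degree-𝟙 (nothing ∷ c) = degree-cong (λ { (_ ∷ x) → refl }) (degree-∘tail (degree-𝟙 c))
degree-𝟙 (just b ∷ c)  = degree-fromRestrictions (face b false) (face b true)
  where
    face : ∀ b b′ → Degree≤ (codim c) (restrict b′ (𝟙 (just b ∷ c)))
    face true  true  = degree-𝟙 c
    face false false = degree-𝟙 c
    face true  false = degree-mono ℕ.z≤n (degree-const 0ℤ)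
    face false true  = degree-mono ℕ.z≤n (degree-const 0ℤ)

∑-𝟙 : ∀ {n} (cs : List (Subcube n)) (a : Subcube n → ℤ) v x →
      (∀ c → c ∈ cs → inCube c x ≡ true → a c ≡ v) →
      (∑ cs λ c → a c * 𝟙 c x) ≡ v * + (∑ℕ cs λ c → [ inCube c x ])
∑-𝟙 []       a v x same = sym (ℤP.*-zeroʳ v)
∑-𝟙 (c ∷ cs) a v x same with inCube c x in x∈c
... | true  = begin
  a c * 1ℤ + ∑ cs (λ c → a c * 𝟙 c x)  ≡⟨ cong₂ _+_ (trans (ℤP.*-identityʳ (a c)) (same c (here refl) x∈c)) ∑-𝟙-cs ⟩
  v + v * + m                          ≡⟨ v+v*m≡v*[1+m] v (+ m) ⟩
  v * (1ℤ + + m)                       ∎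
  where
    open ≡-Reasoning
    m = ∑ℕ cs λ c → [ inCube c x ]
    ∑-𝟙-cs = ∑-𝟙 cs a v x (λ c c∈ → same c (there c∈))
    v+v*m≡v*[1+m] : ∀ v m → v + v * m ≡ v * (1ℤ + m)
    v+v*m≡v*[1+m] = solve-∀
... | false =
  trans (cong₂ _+_ (ℤP.*-zeroʳ (a c)) (∑-𝟙 cs a v x (λ c c∈ → same c (there c∈)))) (ℤP.+-identityˡ _)

fixed : ∀ {n} → Subcube n → Fin n → Bool
fixed c i = is-just (lookup c i)

codim≡∑fixed : ∀ {n} (c : Subcube n) → codim c ≡ ∑ℕ (allFin n) λ i → [ fixed c i ]
codim≡∑fixed []                = refl
codim≡∑fixed {suc n} (m ∷ c) = trans (step m) (sym (∑ℕ-allFin-suc n λ i → [ fixed (m ∷ c) i ]))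
  where
    step : ∀ m → codim (m ∷ c) ≡ [ is-just m ] ℕ.+ ∑ℕ (allFin n) (λ i → [ fixed c i ])
    step nothing  = codim≡∑fixed c
    step (just _) = cong suc (codim≡∑fixed c)

inCube⇒lookup : ∀ {n} (c : Subcube n) y → inCube c y ≡ true →
                ∀ k {b} → lookup c k ≡ just b → lookup y k ≡ b
inCube⇒lookup (nothing ∷ c) (x ∷ y) y∈c (suc k) ck≡b = inCube⇒lookup c y y∈c k ck≡b
inCube⇒lookup (just b ∷ c)  (x ∷ y) y∈c zero refl with b | x | y∈c
... | true  | true  | _ = refl
... | false | false | _ = refl
inCube⇒lookup (just b ∷ c)  (x ∷ y) y∈c (suc k) ck≡b = inCube⇒lookup c y (proj₂ (∧≡true y∈c)) k ck≡b

lookup⇒inCube : ∀ {n} (c : Subcube n) y →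
                (∀ k {b} → lookup c k ≡ just b → lookup y k ≡ b) → inCube c y ≡ true
lookup⇒inCube []            []      agree = refl
lookup⇒inCube (nothing ∷ c) (x ∷ y) agree = lookup⇒inCube c y λ k → agree (suc k)
lookup⇒inCube (just b ∷ c)  (x ∷ y) agree with agree zero refl
lookup⇒inCube (just true ∷ c)  (.true ∷ y)  agree | refl = lookup⇒inCube c y λ k → agree (suc k)
lookup⇒inCube (just false ∷ c) (.false ∷ y) agree | refl = lookup⇒inCube c y λ k → agree (suc k)

toggled-corner∉ : ∀ {n} (c : Subcube n) i → (fixed c i ∧ inCube c (corner c [ i ]%= not)) ≡ false
toggled-corner∉ c i with lookup c i in ci
... | nothing = refl
... | just b with inCube c (corner c [ i ]%= not) in y∈c
...   | false = refl
...   | true  = ⊥-elim (not-¬ {b} refl (sym (begin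
  not b                                 ≡⟨ cong not (inCube⇒lookup c (corner c) (corner∈ c) i ci) ⟨
  not (lookup (corner c) i)             ≡⟨ lookup∘updateAt i (corner c) ⟨
  lookup (corner c [ i ]%= not) i       ≡⟨ inCube⇒lookup c _ y∈c i ci ⟩
  b                                     ∎)))
  where open ≡-Reasoning

toggled-both∈⇒∈ : ∀ {n} (c : Subcube n) y {i j} → i ≢ j →
  inCube c (y [ i ]%= not) ≡ true → inCube c (y [ j ]%= not) ≡ true → inCube c y ≡ true
toggled-both∈⇒∈ c y {i} {j} i≢j yi∈c yj∈c = lookup⇒inCube c y agree
  where
    agree : ∀ k {b} → lookup c k ≡ just b → lookup y k ≡ b
    agree k ck≡b with k FinP.≟ i
    ... | yes refl = trans (sym (lookup∘updateAt′ k j i≢j y)) (inCube⇒lookup c _ yj∈c k ck≡b)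
    ... | no  k≢i  = trans (sym (lookup∘updateAt′ k i k≢i y)) (inCube⇒lookup c _ yi∈c k ck≡b)

-- Double counting: the corner y of c and its toggles in the fixed directions of c lie in
-- 1 + codim c distinct cubes, because no cube contains two of these points.
codim<length : ∀ {n} {cs : List (Subcube n)} → (∀ x → (∑ℕ cs λ c → [ inCube c x ]) ≡ 1) →
               ∀ {c} → c ∈ cs → codim c < length cs
codim<length {n} {cs} once {c} c∈cs = begin-strict
  codim c          <⟨ ℕP.n<1+n _ ⟩
  suc (codim c)    ≡⟨ ∑hits ⟨
  ∑ℕ cs hits       ≤⟨ ∑ℕ≤length cs hits hits≤1 ⟩
  length cs        ∎
  where
    open ℕP.≤-Reasoning
    y = corner c
    hit : Fin n → Subcube n → Bool
    hit i c′ = fixed c i ∧ inCube c′ (y [ i ]%= not)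
    hits : Subcube n → ℕ
    hits c′ = [ inCube c′ y ] ℕ.+ ∑ℕ (allFin n) λ i → [ hit i c′ ]

    ∑hit : ∀ i → (∑ℕ cs λ c′ → [ hit i c′ ]) ≡ [ fixed c i ]
    ∑hit i with fixed c i
    ... | true  = once (y [ i ]%= not)
    ... | false = ℕ∑.∑-zero cs λ _ _ → refl

    ∑hits : ∑ℕ cs hits ≡ suc (codim c)
    ∑hits = begin-equality
      ∑ℕ cs hits
        ≡⟨ ℕ∑.∑-distrib-+ cs _ _ ⟩
      (∑ℕ cs λ c′ → [ inCube c′ y ]) ℕ.+ (∑ℕ cs λ c′ → ∑ℕ (allFin n) λ i → [ hit i c′ ])
        ≡⟨ cong₂ ℕ._+_ (once y) (ℕ∑.∑-comm cs (allFin n) λ c′ i → [ hit i c′ ]) ⟩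
      suc (∑ℕ (allFin n) λ i → ∑ℕ cs λ c′ → [ hit i c′ ])
        ≡⟨ cong suc (ℕ∑.∑-cong (allFin n) λ i _ → ∑hit i) ⟩
      suc (∑ℕ (allFin n) λ i → [ fixed c i ])
        ≡⟨ cong suc (codim≡∑fixed c) ⟨
      suc (codim c) ∎

    hits≤1 : ∀ c′ → c′ ∈ cs → hits c′ ≤ 1
    hits≤1 c′ c′∈cs with inCube c′ y in y∈c′
    ... | true rewrite count≡1⇒unique (λ d → inCube d y) (once y) c′∈cs c∈cs y∈c′ (corner∈ c) =
      ℕP.≤-reflexive (cong suc (ℕ∑.∑-zero (allFin n) λ i _ → cong [_] (toggled-corner∉ c i)))
    ... | false = ∑ℕ-allFin-≤1 n (λ i → hit i c′) atMostOneHit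
      where
        atMostOneHit : ∀ i j → hit i c′ ≡ true → hit j c′ ≡ true → i ≡ j
        atMostOneHit i j hi hj with i FinP.≟ j
        ... | yes i≡j = i≡j
        ... | no  i≢j
          with () ← trans (sym y∈c′) (toggled-both∈⇒∈ c′ y i≢j (proj₂ (∧≡true hi)) (proj₂ (∧≡true hj)))

PartitionSizeAtMost⇒Degree≤ : ∀ {K n} {f : BoolFun n} → PartitionSizeAtMost K f → Degree≤ K (asℤ f)
PartitionSizeAtMost⇒Degree≤ {K} {n} {f} (cs , (covers , constant) , length≤K) =
  degree-cong expansion
    (degree-∑ cs _ λ c c∈cs → degree-*ˡ (sign (f (corner c))) (degree-mono (codim≤K c∈cs) (degree-𝟙 c)))
  where
    once : ∀ x → (∑ℕ cs λ c → [ inCube c x ]) ≡ 1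
    once x = trans (sym (length-filterᵇ (λ c → inCube c x) cs)) (covers x)
    codim≤K : ∀ {c} → c ∈ cs → codim c ≤ K
    codim≤K c∈cs = ℕP.<⇒≤ (ℕP.<-≤-trans (codim<length once c∈cs) length≤K)
    expansion : ∀ x → (∑ cs λ c → sign (f (corner c)) * 𝟙 c x) ≡ asℤ f x
    expansion x = begin
      (∑ cs λ c → sign (f (corner c)) * 𝟙 c x)
        ≡⟨ ∑-𝟙 cs _ (sign (f x)) x (λ c c∈cs x∈c → cong sign (constant c c∈cs (corner c) x (corner∈ c) x∈c)) ⟩
      sign (f x) * + (∑ℕ cs λ c → [ inCube c x ])
        ≡⟨ cong (λ m → sign (f x) * + m) (once x) ⟩
      sign (f x) * 1ℤ
        ≡⟨ ℤP.*-identityʳ _ ⟩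
      sign (f x) ∎
      where open ≡-Reasoning

-- Sparsity

sparsity : ∀ {n} → ℤFun n → ℕ
sparsity {n} g = ∑ℕ (allVecs n) λ S → [ not0 (coeff g S) ]

[a]+[a±b]≤[a+b]+[a-b] : ∀ a b z → (a + b ≡ 0ℤ → a - b ≡ 0ℤ → z ≡ 0ℤ) →
  [ not0 z ] ℕ.+ [ not0 (a + b) ∧ not0 (a - b) ] ≤ [ not0 (a + b) ] ℕ.+ [ not0 (a - b) ]
[a]+[a±b]≤[a+b]+[a-b] a b z vanishes with not0 (a + b) in a+b≢0 | not0 (a - b) in a-b≢0
... | true  | true  = ℕP.+-monoˡ-≤ 1 ([b]≤1 _)
... | true  | false = ℕP.+-monoˡ-≤ 0 ([b]≤1 _)
... | false | true  = ℕP.+-monoˡ-≤ 0 ([b]≤1 _)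
... | false | false rewrite vanishes (not0≡false⇒≡0 a+b≢0) (not0≡false⇒≡0 a-b≢0) = ℕ.z≤n

module _ {n : ℕ} (g : ℤFun (suc n)) where

  private
    a b : Subset n → ℤ
    a = coeff (restrict false g)
    b = coeff (restrict true g)

  bothNonzero : Subset n → Bool
  bothNonzero S = not0 (a S + b S) ∧ not0 (a S - b S)

  sparsity-restrict : ∀ x → sparsity (restrict x g) ℕ.+ ∑ℕ (allVecs n) (λ S → [ bothNonzero S ]) ≤ sparsity g
  sparsity-restrict x = begin
    sparsity (restrict x g) ℕ.+ ∑ℕ (allVecs n) (λ S → [ bothNonzero S ])
      ≡⟨ ℕ∑.∑-distrib-+ (allVecs n) _ _ ⟨
    ∑ℕ (allVecs n) (λ S → [ not0 (coeff (restrict x g) S) ] ℕ.+ [ bothNonzero S ])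
      ≤⟨ ∑ℕ-mono-≤ (allVecs n) (λ S _ → [a]+[a±b]≤[a+b]+[a-b] (a S) (b S) _ (vanishes x S)) ⟩
    ∑ℕ (allVecs n) (λ S → [ not0 (a S + b S) ] ℕ.+ [ not0 (a S - b S) ])
      ≡⟨ ℕ∑.∑-distrib-+ (allVecs n) _ _ ⟩
    ∑ℕ (allVecs n) (λ S → [ not0 (a S + b S) ]) ℕ.+ ∑ℕ (allVecs n) (λ S → [ not0 (a S - b S) ])
      ≡⟨ cong₂ ℕ._+_ (ℕ∑.∑-cong (allVecs n) λ S _ → cong (λ z → [ not0 z ]) (coeff-false∷ g S))
                     (ℕ∑.∑-cong (allVecs n) λ S _ → cong (λ z → [ not0 z ]) (coeff-true∷ g S)) ⟨
    ∑ℕ (allVecs n) (λ S → [ not0 (coeff g (false ∷ S)) ]) ℕ.+ ∑ℕ (allVecs n) (λ S → [ not0 (coeff g (true ∷ S)) ])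
      ≡⟨ ℕ∑.∑-allVecs-suc n _ ⟨
    sparsity g ∎
    where
      open ℕP.≤-Reasoning
      vanishes : ∀ x S → a S + b S ≡ 0ℤ → a S - b S ≡ 0ℤ → coeff (restrict x g) S ≡ 0ℤ
      vanishes false S = i+j≡0∧i-j≡0⇒i≡0 (a S) (b S)
      vanishes true  S = i+j≡0∧i-j≡0⇒j≡0 (a S) (b S)

zero-or-double : ∀ a b → (not0 (a + b) ∧ not0 (a - b)) ≡ false →
  (a + b ≡ 0ℤ ⊎ a + b ≡ a + a) × (a - b ≡ 0ℤ ⊎ a - b ≡ a + a)
zero-or-double a b notBoth with not0 (a + b) in a+b≢0 | not0 (a - b) in a-b≢0
... | false | _     = inj₁ (not0≡false⇒≡0 a+b≢0) , inj₂ (i+j≡0⇒i-j≡i+i a b (not0≡false⇒≡0 a+b≢0))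
... | true  | false = inj₂ (i-j≡0⇒i+j≡i+i a b (not0≡false⇒≡0 a-b≢0)) , inj₁ (not0≡false⇒≡0 a-b≢0)

dyadic-zero-or-double : ∀ n s {a u} → + (2 ^ n) ∣ + (2 ^ s) * a → u ≡ 0ℤ ⊎ u ≡ a + a →
                        + (2 ^ suc n) ∣ + (2 ^ s) * u
dyadic-zero-or-double n s 2ⁿ∣2ˢa (inj₁ refl) = subst (_ ∣_) (sym (ℤP.*-zeroʳ (+ (2 ^ s)))) (∣0ℤ _)
dyadic-zero-or-double n s {a} 2ⁿ∣2ˢa (inj₂ refl) =
  subst (_ ∣_) (sym (c*[a+a]≡2*[c*a] (+ (2 ^ s)) a)) (∣-double n 2ⁿ∣2ˢa)
  where
    c*[a+a]≡2*[c*a] : ∀ c a → c * (a + a) ≡ (1ℤ + 1ℤ) * (c * a)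
    c*[a+a]≡2*[c*a] = solve-∀

granularity-noneBothNonzero : ∀ {n s} (g : ℤFun (suc n)) → Granularity≤ s (restrict false g) →
  (∀ S → bothNonzero g S ≡ false) → Granularity≤ s g
dyadic (granularity-noneBothNonzero {n} {s} g gran₀ none) (false ∷ S) =
  subst (λ u → _ ∣ + (2 ^ s) * u) (sym (coeff-false∷ g S))
        (dyadic-zero-or-double n s (dyadic gran₀ S) (proj₁ (zero-or-double a b (none S))))
  where
    a = coeff (restrict false g) S
    b = coeff (restrict true g) S
dyadic (granularity-noneBothNonzero {n} {s} g gran₀ none) (true ∷ S) =
  subst (λ u → _ ∣ + (2 ^ s) * u) (sym (coeff-true∷ g S))
        (dyadic-zero-or-double n s (dyadic gran₀ S) (proj₂ (zero-or-double a b (none S))))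
  where
    a = coeff (restrict false g) S
    b = coeff (restrict true g) S

-- With a, b the coefficients of the two restrictions: if a + b and a - b are both nonzero at some S,
-- each restriction has sparsity below s; otherwise every coefficient a ± b of g is 0 or 2a.
sparsity⇒granularity : ∀ {n s} (g : ℤFun n) → sparsity g ≤ s → Granularity≤ s g
dyadic (sparsity⇒granularity {zero} g _) [] = ∣ᵤ⇒∣ (ND.1∣ _)
sparsity⇒granularity {suc n} {s} g sparse with ∑ℕ (allVecs n) (λ S → [ bothNonzero g S ]) in B≡
... | zero = granularity-noneBothNonzero g (sparsity⇒granularity (restrict false g) (restricted false))
               λ S → [b]≡0⇒b≡false (∑ℕ≡0⇒≡0 (λ S → [ bothNonzero g S ]) B≡ (allVecs-complete S))
  where
    restricted : ∀ x → sparsity (restrict x g) ≤ s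
    restricted x = ℕP.≤-trans (ℕP.m≤m+n _ _) (ℕP.≤-trans (sparsity-restrict g x) sparse)
... | suc m = step s restricted<
  where
    restricted< : ∀ x → sparsity (restrict x g) < s
    restricted< x = ℕP.<-≤-trans (ℕP.m<m+n _ ℕ.z<s)
      (subst (λ B → sparsity (restrict x g) ℕ.+ B ≤ s) B≡ (ℕP.≤-trans (sparsity-restrict g x) sparse))
    step : ∀ s → (∀ x → sparsity (restrict x g) < s) → Granularity≤ s g
    step zero     restricted< = ⊥-elim (ℕP.n≮0 (restricted< false))
    step (suc s′) restricted< = granularity-fromRestrictions (sparser false) (sparser true)
      where
        sparser : ∀ x → Granularity≤ s′ (restrict x g)
        sparser x = sparsity⇒granularity (restrict x g) (ℕ.s≤s⁻¹ (restricted< x))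

SparsityAtMost⇒Granularity≤ : ∀ {K n} {f : BoolFun n} → SparsityAtMost K f → Granularity≤ K (asℤ f)
SparsityAtMost⇒Granularity≤ {n = n} {f} sparse =
  sparsity⇒granularity (asℤ f) (subst (_≤ _) (length-filterᵇ (λ S → not0 (fourierNum f S)) (allVecs n)) sparse)

SomeMeasureAtMost⇒Granularity≤ : ∀ {K n} {f : BoolFun n} → SomeMeasureAtMost K f → Granularity≤ K (asℤ f)
SomeMeasureAtMost⇒Granularity≤ (inj₁ partition) = degree⇒granularity (PartitionSizeAtMost⇒Degree≤ partition)
SomeMeasureAtMost⇒Granularity≤ (inj₂ (inj₁ deg)) = degree⇒granularity (DegreeAtMost⇒Degree≤ deg)
SomeMeasureAtMost⇒Granularity≤ (inj₂ (inj₂ (inj₁ tree))) = degree⇒granularity (DTDepthAtMost⇒Degree≤ tree)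
SomeMeasureAtMost⇒Granularity≤ (inj₂ (inj₂ (inj₂ (inj₁ tree)))) = degree⇒granularity (DTSizeAtMost⇒Degree≤ tree)
SomeMeasureAtMost⇒Granularity≤ (inj₂ (inj₂ (inj₂ (inj₂ (inj₁ gran))))) = GranularityAtMost⇒Granularity≤ gran
SomeMeasureAtMost⇒Granularity≤ (inj₂ (inj₂ (inj₂ (inj₂ (inj₂ sparse))))) = SparsityAtMost⇒Granularity≤ sparse

-- Entropy and influence

entropyConstant : ℕ → ℕ
entropyConstant K = 2 ℕ.* K ℕ.* (1 ℕ.+ 4 ^ K)

0<entropyConstant : ∀ {K} → 1 ≤ K → 0 < entropyConstant K
0<entropyConstant 1≤K = ℕP.*-mono-≤ (ℕP.*-mono-≤ {1} {2} (ℕ.s≤s ℕ.z≤n) 1≤K) (ℕ.s≤s ℕ.z≤n)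

∣sign∣≡1 : ∀ b → ℤ.∣ sign b ∣ ≡ 1
∣sign∣≡1 false = refl
∣sign∣≡1 true  = refl

∣chi∣≡1 : ∀ {n} (S : Subset n) x → ℤ.∣ chi S x ∣ ≡ 1
∣chi∣≡1 []      []      = refl
∣chi∣≡1 (s ∷ S) (b ∷ x) =
  trans (ℤP.∣i*j∣≡∣i∣*∣j∣ (if s then sign b else 1ℤ) (chi S x)) (cong₂ ℕ._*_ (∣factor∣≡1 s) (∣chi∣≡1 S x))
  where
    ∣factor∣≡1 : ∀ s → ℤ.∣ (if s then sign b else 1ℤ) ∣ ≡ 1
    ∣factor∣≡1 true  = ∣sign∣≡1 b
    ∣factor∣≡1 false = refl

∣fourierNum∣≤2^n : ∀ {n} (f : BoolFun n) S → ℤ.∣ fourierNum f S ∣ ≤ 2 ^ n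
∣fourierNum∣≤2^n {n} f S = begin
  ℤ.∣ fourierNum f S ∣                                ≤⟨ ∣∑∣≤∑∣∣ (allVecs n) _ ⟩
  ∑ℕ (allVecs n) (λ x → ℤ.∣ sign (f x) * chi S x ∣)  ≤⟨ ∑ℕ-mono-≤ (allVecs n) (λ x _ → ℕP.≤-reflexive ∣term∣≡1) ⟩
  ∑ℕ (allVecs n) (λ _ → 1)                            ≡⟨ ∑1-allVecs≡2^n n ⟩
  2 ^ n                                               ∎
  where
    open ℕP.≤-Reasoning
    ∣term∣≡1 : ∀ {x} → ℤ.∣ sign (f x) * chi S x ∣ ≡ 1
    ∣term∣≡1 {x} = trans (ℤP.∣i*j∣≡∣i∣*∣j∣ (sign (f x)) (chi S x)) (cong₂ ℕ._*_ (∣sign∣≡1 (f x)) (∣chi∣≡1 S x))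

weight≤4^n : ∀ {n} (f : BoolFun n) S → weight f S ≤ 4 ^ n
weight≤4^n {n} f S = subst (weight f S ≤_) ([2^n]^2≡4^n n) (ℕP.^-monoˡ-≤ 2 (∣fourierNum∣≤2^n f S))

-- A nonzero multiple of 2⁻ᵏ has absolute value at least 2⁻ᵏ.
4^n≤4^K*weight : ∀ {K n} {f : BoolFun n} → Granularity≤ K (asℤ f) →
                 ∀ S → fourierNum f S ≢ 0ℤ → 4 ^ n ≤ 4 ^ K ℕ.* weight f S
4^n≤4^K*weight {K} {n} {f} gran S nonzero = begin
  4 ^ n                   ≡⟨ [2^n]^2≡4^n n ⟨
  (2 ^ n) ^ 2             ≤⟨ ℕP.^-monoˡ-≤ 2 2ⁿ≤2ᴷβ ⟩
  (2 ^ K ℕ.* β) ^ 2       ≡⟨ [m*n]^k≡m^k*n^k (2 ^ K) β 2 ⟩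
  (2 ^ K) ^ 2 ℕ.* β ^ 2   ≡⟨ cong (ℕ._* β ^ 2) ([2^n]^2≡4^n K) ⟩
  4 ^ K ℕ.* weight f S    ∎
  where
    open ℕP.≤-Reasoning
    β = ℤ.∣ fourierNum f S ∣
    instance
      2ᴷβ≢0 : ℕ.NonZero (2 ^ K ℕ.* β)
      2ᴷβ≢0 = ℕP.m*n≢0 (2 ^ K) β {{ℕP.m^n≢0 2 K}} {{ℕ.≢-nonZero (nonzero ∘ ℤP.∣i∣≡0⇒i≡0)}}
    2ⁿ≤2ᴷβ : 2 ^ n ≤ 2 ^ K ℕ.* β
    2ⁿ≤2ᴷβ = ND.∣⇒≤ (subst (2 ^ n ND.∣_) (ℤP.∣i*j∣≡∣i∣*∣j∣ (+ (2 ^ K)) (fourierNum f S)) (∣⇒∣ᵤ (dyadic gran S)))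

weight-term≤ : ∀ {K n} {f : BoolFun n} → Granularity≤ K (asℤ f) → ∀ S →
  (4 ^ n) ^ weight f S ≤ 2 ^ (2 ℕ.* K ℕ.* weight f S) ℕ.* weight f S ^ weight f S
weight-term≤ {K} {n} {f} gran S with fourierNum f S ℤ.≟ 0ℤ
... | yes c≡0 rewrite c≡0 = subst (1 ≤_) (sym (ℕP.*-identityʳ _)) (ℕP.m^n>0 2 (2 ℕ.* K ℕ.* 0))
... | no  c≢0 = begin
  (4 ^ n) ^ a                         ≤⟨ ℕP.^-monoˡ-≤ a (4^n≤4^K*weight gran S c≢0) ⟩
  (4 ^ K ℕ.* a) ^ a                   ≡⟨ [m*n]^k≡m^k*n^k (4 ^ K) a a ⟩
  (4 ^ K) ^ a ℕ.* a ^ a               ≡⟨ cong (λ m → m ^ a ℕ.* a ^ a) (ℕP.^-*-assoc 2 2 K) ⟩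
  (2 ^ (2 ℕ.* K)) ^ a ℕ.* a ^ a       ≡⟨ cong (ℕ._* a ^ a) (ℕP.^-*-assoc 2 (2 ℕ.* K) a) ⟩
  2 ^ (2 ℕ.* K ℕ.* a) ℕ.* a ^ a       ∎
  where
    open ℕP.≤-Reasoning
    a = weight f S

entropyBound-fromExponents : ∀ {n} (f : BoolFun n) C (e : Subset n → ℕ) →
  (∀ S → (4 ^ n) ^ weight f S ≤ 2 ^ e S ℕ.* weight f S ^ weight f S) →
  ∑ℕ (allVecs n) e ≤ C ℕ.* influenceNum f → EntropyInfluenceBound C f
entropyBound-fromExponents {n} f C e term≤ ∑e≤ =
  ℕP.≤-trans (∏≤2^∑*∏ (allVecs n) _ _ e term≤) (ℕP.*-monoˡ-≤ _ (ℕP.^-monoʳ-≤ 2 ∑e≤))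

entropyBound-degree0 : ∀ {n} (f : BoolFun n) C → Degree≤ 0 (asℤ f) → EntropyInfluenceBound C f
entropyBound-degree0 {n} f C deg0 = entropyBound-fromExponents f C (λ _ → 0) term≤
  (subst (_≤ C ℕ.* influenceNum f) (sym (ℕ∑.∑-zero (allVecs n) λ _ _ → refl)) ℕ.z≤n)
  where
    term≤ : ∀ S → (4 ^ n) ^ weight f S ≤ 2 ^ 0 ℕ.* weight f S ^ weight f S
    term≤ S with ∣ S ∣ ℕ.≟ 0
    ... | yes ∣S∣≡0 =
      subst (λ w → (4 ^ n) ^ w ≤ 2 ^ 0 ℕ.* w ^ w) (sym weight≡4^n) (ℕP.≤-reflexive (sym (ℕP.+-identityʳ _)))
      where
        x = replicate n false
        ∣c∣≡2^n : ℤ.∣ fourierNum f S ∣ ≡ 2 ^ n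
        ∣c∣≡2^n = begin
          ℤ.∣ fourierNum f S ∣                ≡⟨ cong ℤ.∣_∣ (degree0⇒constant deg0 {S} ∣S∣≡0 x) ⟩
          ℤ.∣ + (2 ^ n) * sign (f x) ∣         ≡⟨ ℤP.∣i*j∣≡∣i∣*∣j∣ (+ (2 ^ n)) (sign (f x)) ⟩
          2 ^ n ℕ.* ℤ.∣ sign (f x) ∣           ≡⟨ cong (2 ^ n ℕ.*_) (∣sign∣≡1 (f x)) ⟩
          2 ^ n ℕ.* 1                         ≡⟨ ℕP.*-identityʳ (2 ^ n) ⟩
          2 ^ n                               ∎
          where open ≡-Reasoning
        weight≡4^n : weight f S ≡ 4 ^ n
        weight≡4^n = trans (cong (_^ 2) ∣c∣≡2^n) ([2^n]^2≡4^n n)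
    ... | no ∣S∣≢0 rewrite vanish deg0 S (ℕP.n≢0⇒n>0 ∣S∣≢0) = ℕP.≤-refl

entropyBound-nonconstant : ∀ {K n} {f : BoolFun n} → Granularity≤ K (asℤ f) →
  ∀ T → 0 < ∣ T ∣ → fourierNum f T ≢ 0ℤ → EntropyInfluenceBound (entropyConstant K) f
entropyBound-nonconstant {K} {n} {f} gran T 0<∣T∣ c≢0 =
  entropyBound-fromExponents f (entropyConstant K) e
    (λ S → ℕP.≤-trans (weight-term≤ gran S) (ℕP.*-monoˡ-≤ _ (ℕP.^-monoʳ-≤ 2 (2Ka≤e S))))
    (ℕP.≤-reflexive ∑e≡CI)
  where
    I = influenceNum f
    X = 2 ℕ.* K ℕ.* (4 ^ K ℕ.* I)
    -- The empty set carries the one term not controlled by I; it is charged to T.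
    e : Subset n → ℕ
    e S = 2 ℕ.* K ℕ.* (weight f S ℕ.* ∣ S ∣) ℕ.+ [ ∣ S ∣ ℕ.≡ᵇ 0 ] ℕ.* X

    weight≤4ᴷI : ∀ S → weight f S ≤ 4 ^ K ℕ.* I
    weight≤4ᴷI S = begin
      weight f S
        ≤⟨ weight≤4^n f S ⟩
      4 ^ n
        ≤⟨ 4^n≤4^K*weight gran T c≢0 ⟩
      4 ^ K ℕ.* weight f T
        ≤⟨ ℕP.*-monoʳ-≤ (4 ^ K) (ℕP.m≤m*n (weight f T) ∣ T ∣ {{ℕ.>-nonZero 0<∣T∣}}) ⟩
      4 ^ K ℕ.* (weight f T ℕ.* ∣ T ∣)
        ≤⟨ ℕP.*-monoʳ-≤ (4 ^ K) (∈⇒≤∑ℕ (λ S → weight f S ℕ.* ∣ S ∣) (allVecs-complete T)) ⟩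
      4 ^ K ℕ.* I ∎
      where open ℕP.≤-Reasoning

    2Ka≤e : ∀ S → 2 ℕ.* K ℕ.* weight f S ≤ e S
    2Ka≤e S with ∣ S ∣
    ... | zero  = begin
      2 ℕ.* K ℕ.* weight f S                      ≤⟨ ℕP.*-monoʳ-≤ (2 ℕ.* K) (weight≤4ᴷI S) ⟩
      X                                          ≡⟨ ℕP.*-identityˡ X ⟨
      1 ℕ.* X                                    ≤⟨ ℕP.m≤n+m (1 ℕ.* X) (2 ℕ.* K ℕ.* (weight f S ℕ.* 0)) ⟩
      2 ℕ.* K ℕ.* (weight f S ℕ.* 0) ℕ.+ 1 ℕ.* X ∎
      where open ℕP.≤-Reasoning
    ... | suc k = ℕP.≤-trans (ℕP.*-monoʳ-≤ (2 ℕ.* K) (ℕP.m≤m*n (weight f S) (suc k))) (ℕP.m≤m+n _ _)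

    ∑e≡CI : ∑ℕ (allVecs n) e ≡ entropyConstant K ℕ.* I
    ∑e≡CI = begin
      ∑ℕ (allVecs n) e
        ≡⟨ ℕ∑.∑-distrib-+ (allVecs n) _ _ ⟩
      ∑ℕ (allVecs n) (λ S → 2 ℕ.* K ℕ.* (weight f S ℕ.* ∣ S ∣)) ℕ.+ ∑ℕ (allVecs n) (λ S → [ ∣ S ∣ ℕ.≡ᵇ 0 ] ℕ.* X)
        ≡⟨ cong₂ ℕ._+_ (ℕ∑.∑-distribˡ-* (allVecs n) (2 ℕ.* K) _) (ℕ∑.∑-distribʳ-* (allVecs n) X _) ⟩
      2 ℕ.* K ℕ.* I ℕ.+ (∑ℕ (allVecs n) λ S → [ ∣ S ∣ ℕ.≡ᵇ 0 ]) ℕ.* X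
        ≡⟨ cong (λ m → 2 ℕ.* K ℕ.* I ℕ.+ m ℕ.* X) (count-empty n) ⟩
      2 ℕ.* K ℕ.* I ℕ.+ 1 ℕ.* X
        ≡⟨ factor (2 ℕ.* K) (4 ^ K) I ⟩
      entropyConstant K ℕ.* I ∎
      where
        open ≡-Reasoning
        factor : ∀ c q i → c ℕ.* i ℕ.+ 1 ℕ.* (c ℕ.* (q ℕ.* i)) ≡ c ℕ.* (1 ℕ.+ q) ℕ.* i
        factor = ℕSolver.solve-∀

granularity⇒entropyBound : ∀ {K n} {f : BoolFun n} → Granularity≤ K (asℤ f) →
                           EntropyInfluenceBound (entropyConstant K) f
granularity⇒entropyBound {K} {f = f} gran with nonconstant-or-degree0 (asℤ f)
... | inj₁ (T , 0<∣T∣ , c≢0) = entropyBound-nonconstant gran T 0<∣T∣ c≢0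
... | inj₂ deg0              = entropyBound-degree0 f (entropyConstant K) deg0

mainTheorem12 : (K : ℕ) → 1 ≤ K →
    ∃[ C ] (0 < C × ((n : ℕ) (f : BoolFun n) →
      SomeMeasureAtMost K f → EntropyInfluenceBound C f))
mainTheorem12 K 1≤K =
  entropyConstant K ,
  0<entropyConstant 1≤K ,
  λ n f measure≤K → granularity⇒entropyBound (SomeMeasureAtMost⇒Granularity≤ measure≤K)
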